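{- For positive integers $k\le \ell$ define the integer polynomial $$P_{k,\ell}(X_k,\dots,X_\ell)=(X_{k+1}-X_k)\prod_{i=k+2}^{\ell}(X_i-X_{i-2})(X_i-X_{i-1}),$$ and for a monomial $m$ let $p_{k,\ell}(m)$ denote the coefficient of $m$ in $P_{k,\ell}$. Then for all $k+2\le \ell$: (1) $p_{k,\ell}\big(X_k\big(\prod_{i=k+1}^{\ell-2}X_i^2\big)X_{\ell-1}X_\ell\big)$ equals $-1$ if $\ell-k\equiv 0\pmod 3$, $1$ if $\ell-k\equiv 1\pmod 3$, and $0$ if $\ell-k\equiv 2\pmod 3$; (2) $p_{k,\ell}\big(X_k\prod_{i=k+1}^{\ell-1}X_i^2\big)$ equals $0$ if $\ell-k\equiv 0\pmod 3$, $-1$ if $\ell-k\equiv 1\pmod 3$, and $1$ if $\ell-k\equiv 2\pmod 3$; (3) $p_{k,\ell}\big(X_k\big(\prod_{i=k+1}^{\ell-2}X_i^2\big)X_{\ell-1}X_\ell\big)=-\,p_{k,\ell}\big(X_kX_{k+1}\big(\prod_{i=k+2}^{\ell-1}X_i^2\big)X_\ell\big)$; (4) $p_{k,\ell}\big(X_k\prod_{i=k+1}^{\ell-1}X_i^2\big)=-\,p_{k,\ell}\big(\big(\prod_{i=k+1}^{\ell-1}X_i^2\big)X_\ell\big)$.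
   Context: Empty products equal $1$. -}

module Defs where

open import Data.Nat as ℕ using (ℕ; zero; suc; _∸_; _≡ᵇ_)
open import Data.Integer as ℤ using (ℤ)
open import Data.Bool using (if_then_else_)
open import Data.Fin using (toℕ)
open import Data.Product using (_×_; _,_)
open import Data.List as List using (List; []; _∷_; _++_)
open import Data.Vec as Vec using (Vec; tabulate; zipWith; replicate)
open import Data.Vec.Properties using (≡-dec)
open import Relation.Nullary using (yes; no)

Mono : ℕ → Set
Mono n = Vec ℕ n

-- the monomial X_i (for i ≥ n this would be the constant monomial; never used so)
mvar : ∀ {n} → ℕ → Mono n
mvar i = tabulate (λ j → if toℕ j ≡ᵇ i then 1 else 0)

mone : ∀ {n} → Mono n
mone = replicate _ 0

_·ₘ_ : ∀ {n} → Mono n → Mono n → Mono n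
_·ₘ_ = zipWith ℕ._+_
infixl 7 _·ₘ_

-- product of f i over a ≤ i ≤ b  (empty product = 1 when b < a)
∏ₘ : ∀ {n} → ℕ → ℕ → (ℕ → Mono n) → Mono n
∏ₘ a b f = go a (suc b ∸ a)
  where
  go : ℕ → ℕ → _
  go i zero    = mone
  go i (suc c) = f i ·ₘ go (suc i) c

-- Integer polynomials in X_0, …, X_{n-1}: formal (unnormalised) sums of terms.
Poly : ℕ → Set
Poly n = List (ℤ × Mono n)

pvar : ∀ {n} → ℕ → Poly n
pvar i = (ℤ.1ℤ , mvar i) ∷ []

pone : ∀ {n} → Poly n
pone = (ℤ.1ℤ , mone) ∷ []

_+ₚ_ : ∀ {n} → Poly n → Poly n → Poly n
_+ₚ_ = _++_

-ₚ_ : ∀ {n} → Poly n → Poly n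
-ₚ_ = List.map (λ { (c , m) → (ℤ.- c , m) })

_-ₚ_ : ∀ {n} → Poly n → Poly n → Poly n
p -ₚ q = p +ₚ (-ₚ q)

_*ₚ_ : ∀ {n} → Poly n → Poly n → Poly n
p *ₚ q = List.concatMap (λ { (c , m) → List.map (λ { (d , m') → (c ℤ.* d , m ·ₘ m') }) q }) p

infixl 7 _*ₚ_
infixl 6 _+ₚ_ _-ₚ_

-- product of f i over a ≤ i ≤ b  (empty product = 1 when b < a)
∏ₚ : ∀ {n} → ℕ → ℕ → (ℕ → Poly n) → Poly n
∏ₚ a b f = go a (suc b ∸ a)
  where
  go : ℕ → ℕ → _
  go i zero    = pone
  go i (suc c) = f i *ₚ go (suc i) c

-- coefficient of a monomial (sum of coefficients of all terms with that monomial)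
coeff : ∀ {n} → Poly n → Mono n → ℤ
coeff [] m = ℤ.0ℤ
coeff ((c , m') ∷ p) m with ≡-dec ℕ._≟_ m' m
... | yes _ = c ℤ.+ coeff p m
... | no  _ = coeff p m

P : (k ℓ : ℕ) → Poly (suc ℓ)
P k ℓ = (pvar (suc k) -ₚ pvar k)
        *ₚ ∏ₚ (suc (suc k)) ℓ (λ i → (pvar i -ₚ pvar (i ∸ 2)) *ₚ (pvar i -ₚ pvar (i ∸ 1)))

p : (k ℓ : ℕ) → Mono (suc ℓ) → ℤ
p k ℓ m = coeff (P k ℓ) m

sq : ∀ {n} → ℕ → Mono n
sq i = mvar i ·ₘ mvar i

m₁ : (k ℓ : ℕ) → Mono (suc ℓ)
m₁ k ℓ = mvar k ·ₘ ∏ₘ (suc k) (ℓ ∸ 2) sq ·ₘ mvar (ℓ ∸ 1) ·ₘ mvar ℓ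

m₂ : (k ℓ : ℕ) → Mono (suc ℓ)
m₂ k ℓ = mvar k ·ₘ ∏ₘ (suc k) (ℓ ∸ 1) sq

m₃ : (k ℓ : ℕ) → Mono (suc ℓ)
m₃ k ℓ = mvar k ·ₘ mvar (suc k) ·ₘ ∏ₘ (suc (suc k)) (ℓ ∸ 1) sq ·ₘ mvar ℓ

m₄ : (k ℓ : ℕ) → Mono (suc ℓ)
m₄ k ℓ = ∏ₘ (suc k) (ℓ ∸ 1) sq ·ₘ mvar ℓ

-- In the product defining P_{k,ℓ} the variable X_j occurs only in the factors with index j, j+1
-- and j+2.  Expanding the factors from left to right, after the factor with index i the exponent
-- of X_{i-2} must be used up and only the remaining exponents of X_{i-1} and X_i need to be
-- remembered, so coefficients obey a transfer recursion along the exponent sequence (tailCoeff).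
-- The four monomials have exponent sequences 2, 2, …, 2 apart from short fixed ends, and each
-- exponent 2 acts on the relevant pairs of coefficients by (a, c) ↦ (c − a, −a), a map of order 3:
-- this gives the dependence on (ℓ − k) mod 3 as well as the sign relations (3) and (4).

module Submission where

open import Defs
open import Data.Nat using (ℕ; _≤_; _+_; _∸_; _%_)
open import Data.Integer using (ℤ; 0ℤ; 1ℤ; -1ℤ; -_)
open import Data.Product using (_×_)
open import Relation.Binary.PropositionalEquality using (_≡_)

open import Algebra.Bundles using (CommutativeMonoid)
open import Data.Bool using (true; false; if_then_else_)
open import Data.Fin using (Fin; toℕ; fromℕ<)
open import Data.Fin.Properties using (toℕ-fromℕ<)
open import Data.Integer using (_-_)
import Data.Integer as ℤ
import Data.Integer.Properties as ℤₚ
open import Data.Integer.Tactic.RingSolver using (solve-∀)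
open import Data.List using (List; []; _∷_; _++_; length; replicate)
import Data.List as List
open import Data.List.Properties using (length-++; length-replicate)
open import Data.List.Relation.Unary.All as All using (All; []; _∷_)
open import Data.List.Relation.Unary.All.Properties using (++⁺; map⁺)
open import Data.Nat using (zero; suc; _<_; _≟_; _≤?_; _≡ᵇ_)
open import Data.Nat.DivMod using ([m+n]%n≡m%n)
import Data.Nat.Properties as ℕₚ
open import Data.Product using (_,_; proj₁; proj₂; uncurry)
open import Data.Vec using ([]; _∷_; lookup)
open import Data.Vec.Properties
  using (≡-dec; ∷-injectiveˡ; ∷-injectiveʳ; lookup-zipWith; lookup∘tabulate; lookup-replicate;
         zipWith-assoc; zipWith-comm; zipWith-identityˡ; zipWith-identityʳ)
open import Function using (_∘_; flip)
open import Relation.Nullary using (yes; no; contradiction)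
open import Relation.Nullary.Decidable using (dec-true; dec-false)
open import Relation.Binary.PropositionalEquality
  using (_≢_; refl; sym; trans; cong; cong₂; subst; isEquivalence; module ≡-Reasoning)

private
  variable
    n : ℕ

·ₘ-assoc : (u v w : Mono n) → (u ·ₘ v) ·ₘ w ≡ u ·ₘ (v ·ₘ w)
·ₘ-assoc = zipWith-assoc ℕₚ.+-assoc

·ₘ-identityˡ : (m : Mono n) → mone ·ₘ m ≡ m
·ₘ-identityˡ = zipWith-identityˡ ℕₚ.+-identityˡ

·ₘ-identityʳ : (m : Mono n) → m ·ₘ mone ≡ m
·ₘ-identityʳ = zipWith-identityʳ ℕₚ.+-identityʳ

monomialMonoid : ℕ → CommutativeMonoid _ _
monomialMonoid n = record
  { Carrier             = Mono n
  ; _≈_                 = _≡_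
  ; _∙_                 = _·ₘ_
  ; ε                   = mone
  ; isCommutativeMonoid = record
    { isMonoid = record
      { isSemigroup = record
        { isMagma = record { isEquivalence = isEquivalence ; ∙-cong = cong₂ _·ₘ_ }
        ; assoc   = ·ₘ-assoc
        }
      ; identity = ·ₘ-identityˡ , ·ₘ-identityʳ
      }
    ; comm = zipWith-comm ℕₚ.+-comm
    }
  }

module MonomialSolver {n : ℕ} where
  open import Algebra.Solver.CommutativeMonoid (monomialMonoid n) public using (solve; _⊜_; _⊕_; id)

·ₘ-cancelˡ : (a u v : Mono n) → a ·ₘ u ≡ a ·ₘ v → u ≡ v
·ₘ-cancelˡ []      []      []      _  = refl
·ₘ-cancelˡ (x ∷ a) (y ∷ u) (z ∷ v) eq =
  cong₂ _∷_ (ℕₚ.+-cancelˡ-≡ x y z (∷-injectiveˡ eq)) (·ₘ-cancelˡ a u v (∷-injectiveʳ eq))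

lookup-·ₘ : (u v : Mono n) (j : Fin n) → lookup (u ·ₘ v) j ≡ lookup u j + lookup v j
lookup-·ₘ u v j = lookup-zipWith _+_ j u v

mpow : ℕ → ℕ → Mono n
mpow i zero    = mone
mpow i (suc a) = mvar i ·ₘ mpow i a

mfrom : ℕ → List ℕ → Mono n
mfrom b []      = mone
mfrom b (x ∷ L) = mpow b x ·ₘ mfrom (suc b) L

mpow-+ : ∀ i a c → mpow {n} i (a + c) ≡ mpow i a ·ₘ mpow i c
mpow-+ i zero    c = sym (·ₘ-identityˡ (mpow i c))
mpow-+ i (suc a) c = trans (cong (mvar i ·ₘ_) (mpow-+ i a c)) (sym (·ₘ-assoc (mvar i) _ _))

mfrom-++ : ∀ b (A B : List ℕ) → mfrom {n} b (A ++ B) ≡ mfrom b A ·ₘ mfrom (b + length A) B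
mfrom-++ b []      B = trans (cong (λ c → mfrom c B) (sym (ℕₚ.+-identityʳ b))) (sym (·ₘ-identityˡ _))
mfrom-++ b (x ∷ A) B = begin
  mpow b x ·ₘ mfrom (suc b) (A ++ B)
    ≡⟨ cong (mpow b x ·ₘ_) (mfrom-++ (suc b) A B) ⟩
  mpow b x ·ₘ (mfrom (suc b) A ·ₘ mfrom (suc b + length A) B)
    ≡⟨ sym (·ₘ-assoc (mpow b x) _ _) ⟩
  mfrom b (x ∷ A) ·ₘ mfrom (suc b + length A) B
    ≡⟨ cong (λ c → mfrom b (x ∷ A) ·ₘ mfrom c B) (sym (ℕₚ.+-suc b (length A))) ⟩
  mfrom b (x ∷ A) ·ₘ mfrom (b + length (x ∷ A)) B ∎
  where open ≡-Reasoning

mfrom-0∷ : ∀ b (L : List ℕ) → mfrom {n} b (0 ∷ L) ≡ mfrom (suc b) L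
mfrom-0∷ b L = ·ₘ-identityˡ (mfrom (suc b) L)

mfrom-·-band : ∀ b p q r y z (L : List ℕ) →
  mfrom {n} b (p ∷ q ∷ r ∷ []) ·ₘ mfrom (suc b) (y ∷ z ∷ L) ≡ mfrom b (p ∷ q + y ∷ r + z ∷ L)
mfrom-·-band b p q r y z L =
  trans (regroup (mpow b p) (mpow (1 + b) q) (mpow (2 + b) r) (mpow (1 + b) y) (mpow (2 + b) z) (mfrom (3 + b) L))
        (sym (cong (mpow b p ·ₘ_) (cong₂ _·ₘ_ (mpow-+ (1 + b) q y) (cong (_·ₘ mfrom (3 + b) L) (mpow-+ (2 + b) r z)))))
  where
  open MonomialSolver
  regroup : ∀ P Q R Y Z T → (P ·ₘ (Q ·ₘ (R ·ₘ mone))) ·ₘ (Y ·ₘ (Z ·ₘ T)) ≡ P ·ₘ ((Q ·ₘ Y) ·ₘ ((R ·ₘ Z) ·ₘ T))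
  regroup = solve 6 (λ P Q R Y Z T → (P ⊕ (Q ⊕ (R ⊕ id))) ⊕ (Y ⊕ (Z ⊕ T)) ⊜ P ⊕ ((Q ⊕ Y) ⊕ ((R ⊕ Z) ⊕ T))) refl

≡ᵇ-true : ∀ {i j} → i ≡ j → (i ≡ᵇ j) ≡ true
≡ᵇ-true {i} {j} = dec-true (i ≟ j)

≡ᵇ-false : ∀ {i j} → i ≢ j → (i ≡ᵇ j) ≡ false
≡ᵇ-false {i} {j} = dec-false (i ≟ j)

lookup-mpow : ∀ i a (j : Fin n) → lookup (mpow i a) j ≡ (if toℕ j ≡ᵇ i then a else 0)
lookup-mpow i zero    j with toℕ j ≡ᵇ i
... | true  = lookup-replicate j 0
... | false = lookup-replicate j 0
lookup-mpow i (suc a) j =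
  trans (lookup-·ₘ (mvar i) (mpow i a) j)
        (trans (cong₂ _+_ (lookup∘tabulate _ j) (lookup-mpow i a j)) (indicator-+ (toℕ j ≡ᵇ i)))
  where
  indicator-+ : ∀ c → (if c then 1 else 0) + (if c then a else 0) ≡ (if c then suc a else 0)
  indicator-+ true  = refl
  indicator-+ false = refl

lookup-mpow-≡ : ∀ {i} a {j : Fin n} → toℕ j ≡ i → lookup (mpow i a) j ≡ a
lookup-mpow-≡ {i = i} a {j} e = trans (lookup-mpow i a j) (cong (if_then a else 0) (≡ᵇ-true e))

lookup-mpow-≢ : ∀ {i} a {j : Fin n} → toℕ j ≢ i → lookup (mpow i a) j ≡ 0
lookup-mpow-≢ {i = i} a {j} e = trans (lookup-mpow i a j) (cong (if_then a else 0) (≡ᵇ-false e))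

lookup-mfrom-< : ∀ {b} L {j : Fin n} → toℕ j < b → lookup (mfrom b L) j ≡ 0
lookup-mfrom-< []      {j} _   = lookup-replicate j 0
lookup-mfrom-< (x ∷ L) {j} j<b =
  trans (lookup-·ₘ (mpow _ x) (mfrom _ L) j)
        (cong₂ _+_ (lookup-mpow-≢ x (ℕₚ.<⇒≢ j<b)) (lookup-mfrom-< L (ℕₚ.m<n⇒m<1+n j<b)))

lookup-mfrom-head : ∀ b x L {j : Fin n} → toℕ j ≡ b → lookup (mfrom b (x ∷ L)) j ≡ x
lookup-mfrom-head b x L {j} refl =
  trans (lookup-·ₘ (mpow _ x) (mfrom _ L) j)
        (trans (cong₂ _+_ (lookup-mpow-≡ x refl) (lookup-mfrom-< L (ℕₚ.n<1+n _))) (ℕₚ.+-identityʳ x))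

lookup-mfrom-tail : ∀ b x L {j : Fin n} → b < toℕ j → lookup (mfrom b (x ∷ L)) j ≡ lookup (mfrom (suc b) L) j
lookup-mfrom-tail b x L {j} b<j =
  trans (lookup-·ₘ (mpow _ x) (mfrom _ L) j) (cong (_+ lookup (mfrom _ L) j) (lookup-mpow-≢ x (ℕₚ.>⇒≢ b<j)))

mone≢ : ∀ {m : Mono n} {e} j → lookup m j ≡ suc e → mone ≢ m
mone≢ {m = m} j m≡1+e refl = ℕₚ.0≢1+n (trans (sym (lookup-replicate j 0)) m≡1+e)

VanishesBelow : ℕ → Mono n → Set
VanishesBelow s m = ∀ j → toℕ j < s → lookup m j ≡ 0

mfrom-vanishes : ∀ b (L : List ℕ) → VanishesBelow b (mfrom {n} b L)
mfrom-vanishes b L j = lookup-mfrom-< L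

·ₘ-vanishes : ∀ {s} {u v : Mono n} → VanishesBelow s u → VanishesBelow s v → VanishesBelow s (u ·ₘ v)
·ₘ-vanishes {u = u} {v} hu hv j j<s = trans (lookup-·ₘ u v j) (cong₂ _+_ (hu j j<s) (hv j j<s))

vanishes-weaken : ∀ {s} {m : Mono n} → VanishesBelow (suc s) m → VanishesBelow s m
vanishes-weaken h j j<s = h j (ℕₚ.m<n⇒m<1+n j<s)

AllMonomials : (Mono n → Set) → Poly n → Set
AllMonomials P = All (P ∘ proj₂)

termMul : ℤ × Mono n → Poly n → Poly n
termMul (c , a) = List.map (λ u → (c ℤ.* proj₁ u , a ·ₘ proj₂ u))

AllMonomials-*ₚ : {P : Mono n → Set} → (∀ {u v} → P u → P v → P (u ·ₘ v)) →
                  ∀ {f g} → AllMonomials P f → AllMonomials P g → AllMonomials P (f *ₚ g)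
AllMonomials-*ₚ {P = P} P-· {g = g} = go
  where
  go : ∀ {f} → AllMonomials P f → AllMonomials P g → AllMonomials P (f *ₚ g)
  go []        Pg = []
  go (Pa ∷ Pf) Pg = ++⁺ (map⁺ (All.map (P-· Pa) Pg)) (go Pf Pg)

coeff-∷-≡ : ∀ c (m' : Mono n) {m} f → m' ≡ m → coeff ((c , m') ∷ f) m ≡ c ℤ.+ coeff f m
coeff-∷-≡ c m' {m} f e with ≡-dec _≟_ m' m
... | yes _   = refl
... | no m'≢m = contradiction e m'≢m

coeff-∷-≢ : ∀ c (m' : Mono n) {m} f → m' ≢ m → coeff ((c , m') ∷ f) m ≡ coeff f m
coeff-∷-≢ c m' {m} f m'≢m with ≡-dec _≟_ m' m
... | yes e = contradiction e m'≢m
... | no _  = refl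

coeff-++ : ∀ (f g : Poly n) m → coeff (f ++ g) m ≡ coeff f m ℤ.+ coeff g m
coeff-++ []              g m = sym (ℤₚ.+-identityˡ _)
coeff-++ ((c , m') ∷ f) g m with ≡-dec _≟_ m' m
... | yes _ = trans (cong (λ v → c ℤ.+ v) (coeff-++ f g m)) (sym (ℤₚ.+-assoc c _ _))
... | no  _ = coeff-++ f g m

coeff-≡0 : ∀ (f : Poly n) {m} → AllMonomials (_≢ m) f → coeff f m ≡ 0ℤ
coeff-≡0 []              []           = refl
coeff-≡0 ((c , m') ∷ f) (m'≢m ∷ ne) = trans (coeff-∷-≢ c m' f m'≢m) (coeff-≡0 f ne)

coeff-termMul : ∀ c (a : Mono n) g m → coeff (termMul (c , a) g) (a ·ₘ m) ≡ c ℤ.* coeff g m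
coeff-termMul c a []             m = sym (ℤₚ.*-zeroʳ c)
coeff-termMul c a ((d , v) ∷ g) m with ≡-dec _≟_ v m
... | yes refl = trans (coeff-∷-≡ (c ℤ.* d) (a ·ₘ v) _ refl)
                       (trans (cong (λ w → c ℤ.* d ℤ.+ w) (coeff-termMul c a g m)) (sym (ℤₚ.*-distribˡ-+ c d _)))
... | no v≢m   = trans (coeff-∷-≢ (c ℤ.* d) (a ·ₘ v) _ (v≢m ∘ ·ₘ-cancelˡ a v m)) (coeff-termMul c a g m)

-- Rewriting the number suc b ∸ a of factors lets the local recursion of ∏ₚ and ∏ₘ unfold.
∏ₚ-zero : ∀ a {b} (f : ℕ → Poly n) → a + 0 ≡ suc b → ∏ₚ a b f ≡ pone
∏ₚ-zero a {b} f e rewrite trans (sym (ℕₚ.+-identityʳ a)) e | ℕₚ.n∸n≡0 b = refl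

∏ₘ-zero : ∀ a {b} (f : ℕ → Mono n) → a + 0 ≡ suc b → ∏ₘ a b f ≡ mone
∏ₘ-zero a {b} f e rewrite trans (sym (ℕₚ.+-identityʳ a)) e | ℕₚ.n∸n≡0 b = refl

+-≡⇒≤ : ∀ a {d c} → a + d ≡ c → a ≤ c
+-≡⇒≤ a {d} e = subst (a ≤_) e (ℕₚ.m≤m+n a d)

+-suc-≡⇒≤ : ∀ {a b d} → a + suc d ≡ suc b → a ≤ b
+-suc-≡⇒≤ {a} {b} {d} e = ℕₚ.≤-pred (+-≡⇒≤ (suc a) (trans (sym (ℕₚ.+-suc a d)) e))

∏ₚ-suc : ∀ a {b d} (f : ℕ → Poly n) → a + suc d ≡ suc b → ∏ₚ a b f ≡ f a *ₚ ∏ₚ (suc a) b f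
∏ₚ-suc a f e rewrite ℕₚ.+-∸-assoc 1 (+-suc-≡⇒≤ e) = refl

∏ₘ-suc : ∀ a {b d} (f : ℕ → Mono n) → a + suc d ≡ suc b → ∏ₘ a b f ≡ f a ·ₘ ∏ₘ (suc a) b f
∏ₘ-suc a f e rewrite ℕₚ.+-∸-assoc 1 (+-suc-≡⇒≤ e) = refl

∏ₘ-sq : ∀ a b d → a + d ≡ suc b → ∏ₘ {n} a b sq ≡ mfrom a (replicate d 2)
∏ₘ-sq a b zero    e = ∏ₘ-zero a sq e
∏ₘ-sq a b (suc d) e =
  trans (∏ₘ-suc a sq e)
        (cong₂ _·ₘ_ (cong (mvar a ·ₘ_) (sym (·ₘ-identityʳ (mvar a))))
                    (∏ₘ-sq (suc a) b d (trans (sym (ℕₚ.+-suc a d)) e)))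

-- Multiplication by a polynomial in three consecutive variables

-- (c , p , q , r) encodes the term c X_b^p X_{b+1}^q X_{b+2}^r, for a base index b.
BandTerm : Set
BandTerm = ℤ × ℕ × ℕ × ℕ

band : ℕ → List BandTerm → Poly n
band b = List.map λ { (c , p , q , r) → (c , mfrom b (p ∷ q ∷ r ∷ [])) }

-- The exponent of X_b must be matched exactly, as X_b occurs in no later factor; the remaining
-- exponents of X_{b+1} and X_{b+2} are handed on to the continuation K.
termStep : BandTerm → ℕ → ℕ → ℕ → (ℕ → ℕ → ℤ) → ℤ
termStep (c , p , q , r) x y z K with p ≟ x | q ≤? y | r ≤? z
... | yes _ | yes _ | yes _ = c ℤ.* K (y ∸ q) (z ∸ r)
... | _     | _     | _     = 0ℤ

bandStep : List BandTerm → ℕ → ℕ → ℕ → (ℕ → ℕ → ℤ) → ℤ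
bandStep []       x y z K = 0ℤ
bandStep (t ∷ ts) x y z K = termStep t x y z K ℤ.+ bandStep ts x y z K

module _ {b : ℕ} (b+2<n : 2 + b < n) {R : Poly n} (R-vanishes : AllMonomials (VanishesBelow (suc b)) R)
         (L : List ℕ) {K : ℕ → ℕ → ℤ} (K-coeff : ∀ y z → coeff R (mfrom (suc b) (y ∷ z ∷ L)) ≡ K y z) where

  private
    j₀ j₁ j₂ : Fin n
    j₀ = fromℕ< (ℕₚ.m+n≤o⇒n≤o 2 b+2<n)
    j₁ = fromℕ< (ℕₚ.m+n≤o⇒n≤o 1 b+2<n)
    j₂ = fromℕ< b+2<n

    b<j₁ : b < toℕ j₁
    b<j₁ = ℕₚ.≤-reflexive (sym (toℕ-fromℕ< _))

    1+b<j₂ : suc b < toℕ j₂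
    1+b<j₂ = ℕₚ.≤-reflexive (sym (toℕ-fromℕ< _))

    lookup₀ : ∀ x y z L' → lookup (mfrom b (x ∷ y ∷ z ∷ L')) j₀ ≡ x
    lookup₀ x y z L' = lookup-mfrom-head b x (y ∷ z ∷ L') (toℕ-fromℕ< _)

    lookup₁ : ∀ x y z L' → lookup (mfrom b (x ∷ y ∷ z ∷ L')) j₁ ≡ y
    lookup₁ x y z L' =
      trans (lookup-mfrom-tail b x (y ∷ z ∷ L') b<j₁) (lookup-mfrom-head (suc b) y (z ∷ L') (toℕ-fromℕ< _))

    lookup₂ : ∀ x y z L' → lookup (mfrom b (x ∷ y ∷ z ∷ L')) j₂ ≡ z
    lookup₂ x y z L' =
      trans (lookup-mfrom-tail b x (y ∷ z ∷ L') (ℕₚ.<-trans (ℕₚ.n<1+n b) 1+b<j₂))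
            (trans (lookup-mfrom-tail (suc b) y (z ∷ L') 1+b<j₂) (lookup-mfrom-head (2 + b) z L' (toℕ-fromℕ< _)))

    j₀<1+b : toℕ j₀ < suc b
    j₀<1+b = ℕₚ.≤-reflexive (cong suc (toℕ-fromℕ< _))

    summand-≡ : ∀ {s t u v w : ℕ} → u ≡ s → v ≡ 0 → w ≡ t → u + v ≡ w → s ≡ t
    summand-≡ refl refl refl e = trans (sym (ℕₚ.+-identityʳ _)) e

    summand-≤ : ∀ {s t u v w : ℕ} → u ≡ s → w ≡ t → u + v ≡ w → s ≤ t
    summand-≤ refl refl e = +-≡⇒≤ _ e

    differ : ∀ c {a M : Mono n} (j : Fin n) →
             (∀ {v} → VanishesBelow (suc b) v → lookup a j + lookup v j ≢ lookup M j) →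
             coeff (termMul (c , a) R) M ≡ 0ℤ
    differ c {a} j h = coeff-≡0 _ (map⁺ (All.map
      (λ {u} u-vanishes e → h {proj₂ u} u-vanishes (trans (sym (lookup-·ₘ a (proj₂ u) j)) (cong (λ w → lookup w j) e)))
      R-vanishes))

  coeff-termMul-band : ∀ c p q r x y z →
    coeff (termMul (c , mfrom b (p ∷ q ∷ r ∷ [])) R) (mfrom b (x ∷ y ∷ z ∷ L)) ≡ termStep (c , p , q , r) x y z K
  coeff-termMul-band c p q r x y z with p ≟ x | q ≤? y | r ≤? z
  ... | no p≢x | _ | _ = differ c j₀ λ v-vanishes e →
    p≢x (summand-≡ (lookup₀ p q r []) (v-vanishes j₀ j₀<1+b) (lookup₀ x y z L) e)
  ... | yes _ | no q≰y | _ = differ c j₁ λ _ e →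
    q≰y (summand-≤ (lookup₁ p q r []) (lookup₁ x y z L) e)
  ... | yes _ | yes _ | no r≰z = differ c j₂ λ _ e →
    r≰z (summand-≤ (lookup₂ p q r []) (lookup₂ x y z L) e)
  ... | yes refl | yes q≤y | yes r≤z = begin
    coeff (termMul (c , a) R) (mfrom b (p ∷ y ∷ z ∷ L))
      ≡⟨ cong (coeff (termMul (c , a) R)) split ⟩
    coeff (termMul (c , a) R) (a ·ₘ mfrom (suc b) (y ∸ q ∷ z ∸ r ∷ L))
      ≡⟨ coeff-termMul c a R _ ⟩
    c ℤ.* coeff R (mfrom (suc b) (y ∸ q ∷ z ∸ r ∷ L))
      ≡⟨ cong (c ℤ.*_) (K-coeff (y ∸ q) (z ∸ r)) ⟩
    c ℤ.* K (y ∸ q) (z ∸ r) ∎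
    where
    open ≡-Reasoning
    a = mfrom b (p ∷ q ∷ r ∷ [])
    split : mfrom b (p ∷ y ∷ z ∷ L) ≡ a ·ₘ mfrom (suc b) (y ∸ q ∷ z ∸ r ∷ L)
    split = sym (trans (mfrom-·-band b p q r (y ∸ q) (z ∸ r) L)
                       (cong₂ (λ y' z' → mfrom b (p ∷ y' ∷ z' ∷ L)) (ℕₚ.m+[n∸m]≡n q≤y) (ℕₚ.m+[n∸m]≡n r≤z)))

  coeff-band-*ₚ : ∀ ts x y z → coeff (band b ts *ₚ R) (mfrom b (x ∷ y ∷ z ∷ L)) ≡ bandStep ts x y z K
  coeff-band-*ₚ []                   x y z = refl
  coeff-band-*ₚ ((c , p , q , r) ∷ ts) x y z =
    trans (coeff-++ (termMul (c , mfrom b (p ∷ q ∷ r ∷ [])) R) (band b ts *ₚ R) (mfrom b (x ∷ y ∷ z ∷ L)))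
          (cong₂ ℤ._+_ (coeff-termMul-band c p q r x y z) (coeff-band-*ₚ ts x y z))

factor : ℕ → Poly n
factor i = (pvar i -ₚ pvar (i ∸ 2)) *ₚ (pvar i -ₚ pvar (i ∸ 1))

factorTerms : List BandTerm
factorTerms = (1ℤ , 0 , 0 , 2) ∷ (-1ℤ , 0 , 1 , 1) ∷ (-1ℤ , 1 , 0 , 1) ∷ (1ℤ , 1 , 1 , 0) ∷ []

edgeTerms : List BandTerm
edgeTerms = (1ℤ , 0 , 0 , 1) ∷ (-1ℤ , 0 , 1 , 0) ∷ []

factor-band : ∀ b → factor {n} (2 + b) ≡ band b factorTerms
factor-band b =
  cong₂ _∷_ (cong (1ℤ ,_)  (X₂X₂ (mvar (2 + b))))
  (cong₂ _∷_ (cong (-1ℤ ,_) (X₂X₁ (mvar (1 + b)) (mvar (2 + b))))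
  (cong₂ _∷_ (cong (-1ℤ ,_) (X₀X₂ (mvar b) (mvar (2 + b))))
  (cong₂ _∷_ (cong (1ℤ ,_)  (X₀X₁ (mvar b) (mvar (1 + b)))) refl)))
  where
  open MonomialSolver
  X₂X₂ : ∀ X₂ → X₂ ·ₘ X₂ ≡ mone ·ₘ (mone ·ₘ ((X₂ ·ₘ (X₂ ·ₘ mone)) ·ₘ mone))
  X₂X₂ = solve 1 (λ X₂ → X₂ ⊕ X₂ ⊜ id ⊕ (id ⊕ ((X₂ ⊕ (X₂ ⊕ id)) ⊕ id))) refl
  X₂X₁ : ∀ X₁ X₂ → X₂ ·ₘ X₁ ≡ mone ·ₘ ((X₁ ·ₘ mone) ·ₘ ((X₂ ·ₘ mone) ·ₘ mone))
  X₂X₁ = solve 2 (λ X₁ X₂ → X₂ ⊕ X₁ ⊜ id ⊕ ((X₁ ⊕ id) ⊕ ((X₂ ⊕ id) ⊕ id))) refl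
  X₀X₂ : ∀ X₀ X₂ → X₀ ·ₘ X₂ ≡ (X₀ ·ₘ mone) ·ₘ (mone ·ₘ ((X₂ ·ₘ mone) ·ₘ mone))
  X₀X₂ = solve 2 (λ X₀ X₂ → X₀ ⊕ X₂ ⊜ (X₀ ⊕ id) ⊕ (id ⊕ ((X₂ ⊕ id) ⊕ id))) refl
  X₀X₁ : ∀ X₀ X₁ → X₀ ·ₘ X₁ ≡ (X₀ ·ₘ mone) ·ₘ ((X₁ ·ₘ mone) ·ₘ (mone ·ₘ mone))
  X₀X₁ = solve 2 (λ X₀ X₁ → X₀ ⊕ X₁ ⊜ (X₀ ⊕ id) ⊕ ((X₁ ⊕ id) ⊕ (id ⊕ id))) refl

edge-band : ∀ b → pvar {n} (2 + b) -ₚ pvar (1 + b) ≡ band b edgeTerms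
edge-band b =
  cong₂ _∷_ (cong (1ℤ ,_) (X₂ (mvar (2 + b)))) (cong₂ _∷_ (cong (-1ℤ ,_) (X₁ (mvar (1 + b)))) refl)
  where
  open MonomialSolver
  X₂ : ∀ X → X ≡ mone ·ₘ (mone ·ₘ ((X ·ₘ mone) ·ₘ mone))
  X₂ = solve 1 (λ X → X ⊜ id ⊕ (id ⊕ ((X ⊕ id) ⊕ id))) refl
  X₁ : ∀ X → X ≡ mone ·ₘ ((X ·ₘ mone) ·ₘ (mone ·ₘ mone))
  X₁ = solve 1 (λ X → X ⊜ id ⊕ ((X ⊕ id) ⊕ (id ⊕ id))) refl

tailCoeff : ℕ → ℕ → List ℕ → ℤ
tailCoeff x       y       (z ∷ L) = bandStep factorTerms x y z (λ y' z' → tailCoeff y' z' L)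
tailCoeff zero    zero    []      = 1ℤ
tailCoeff zero    (suc _) []      = 0ℤ
tailCoeff (suc _) _       []      = 0ℤ

windowCoeff : ℕ → ℕ → List ℕ → ℤ
windowCoeff x y L = bandStep edgeTerms 0 x y (λ y' z' → tailCoeff y' z' L)

band-vanishes : ∀ b ts → AllMonomials (VanishesBelow b) (band {n} b ts)
band-vanishes b []                   = []
band-vanishes b ((c , p , q , r) ∷ ts) = mfrom-vanishes b (p ∷ q ∷ r ∷ []) ∷ band-vanishes b ts

coeff-pone : ∀ {b} x y → suc b < n → coeff pone (mfrom {n} b (x ∷ y ∷ [])) ≡ tailCoeff x y []
coeff-pone {n = n} {b = b} zero zero _ =
  coeff-∷-≡ 1ℤ mone [] (sym (trans (·ₘ-identityˡ (mone ·ₘ mone)) (·ₘ-identityˡ (mfrom {n} (2 + b) []))))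
coeff-pone {b = b} (suc x) y       1+b<n =
  coeff-∷-≢ 1ℤ mone [] (mone≢ j (lookup-mfrom-head b (suc x) (y ∷ []) {j} (toℕ-fromℕ< b<n)))
  where
  b<n = ℕₚ.<-trans (ℕₚ.n<1+n b) 1+b<n
  j = fromℕ< b<n
coeff-pone {b = b} zero    (suc y) 1+b<n =
  coeff-∷-≢ 1ℤ mone [] (mone≢ j
    (trans (lookup-mfrom-tail b 0 (suc y ∷ []) (ℕₚ.≤-reflexive (sym (toℕ-fromℕ< 1+b<n))))
           (lookup-mfrom-head (suc b) (suc y) [] {j} (toℕ-fromℕ< 1+b<n))))
  where
  j = fromℕ< 1+b<n

∏-factor-vanishes : ∀ {ℓ} b d → 2 + b + d ≡ suc ℓ → AllMonomials (VanishesBelow b) (∏ₚ {suc ℓ} (2 + b) ℓ factor)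
∏-factor-vanishes b zero    e =
  subst (AllMonomials _) (sym (∏ₚ-zero (2 + b) factor e)) ((λ j _ → lookup-replicate j 0) ∷ [])
∏-factor-vanishes b (suc d) e =
  subst (AllMonomials _) (sym (∏ₚ-suc (2 + b) factor e))
        (AllMonomials-*ₚ (λ {u} {v} → ·ₘ-vanishes {u = u} {v}) first-vanishes
                         (All.map (λ {t} → vanishes-weaken {m = proj₂ t}) rest-vanishes))
  where
  first-vanishes = subst (AllMonomials _) (sym (factor-band b)) (band-vanishes b factorTerms)
  rest-vanishes  = ∏-factor-vanishes (suc b) d (trans (sym (ℕₚ.+-suc (2 + b) d)) e)

coeff-∏-factor : ∀ {ℓ} b L x y → 2 + b + length L ≡ suc ℓ →
                 coeff (∏ₚ {suc ℓ} (2 + b) ℓ factor) (mfrom b (x ∷ y ∷ L)) ≡ tailCoeff x y L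
coeff-∏-factor b []      x y e =
  trans (cong (λ f → coeff f (mfrom b (x ∷ y ∷ []))) (∏ₚ-zero (2 + b) factor e)) (coeff-pone x y (+-≡⇒≤ (2 + b) e))
coeff-∏-factor {ℓ} b (z ∷ L) x y e = begin
  coeff (∏ₚ (2 + b) ℓ factor) M
    ≡⟨ cong (λ f → coeff f M) (trans (∏ₚ-suc (2 + b) factor e) (cong (_*ₚ ∏ₚ (3 + b) ℓ factor) (factor-band b))) ⟩
  coeff (band b factorTerms *ₚ ∏ₚ (3 + b) ℓ factor) M
    ≡⟨ coeff-band-*ₚ (+-≡⇒≤ (3 + b) e′) (∏-factor-vanishes (suc b) (length L) e′) L
                     (λ y' z' → coeff-∏-factor (suc b) L y' z' e′) factorTerms x y z ⟩
  tailCoeff x y (z ∷ L) ∎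
  where
  open ≡-Reasoning
  M = mfrom b (x ∷ y ∷ z ∷ L)
  e′ : 3 + b + length L ≡ suc ℓ
  e′ = trans (sym (ℕₚ.+-suc (2 + b) (length L))) e

-- The first factor X_{k+1} − X_k is treated as a polynomial in X_{k-1}, X_k, X_{k+1}; hence k ≥ 1.
p-window : ∀ {ℓ} b x y L → 3 + b + length L ≡ suc ℓ → p (suc b) ℓ (mfrom (suc b) (x ∷ y ∷ L)) ≡ windowCoeff x y L
p-window {ℓ} b x y L e = begin
  coeff (P (suc b) ℓ) (mfrom (suc b) (x ∷ y ∷ L))
    ≡⟨ cong₂ coeff (cong (_*ₚ ∏ₚ (3 + b) ℓ factor) (edge-band b)) (sym (mfrom-0∷ b (x ∷ y ∷ L))) ⟩
  coeff (band b edgeTerms *ₚ ∏ₚ (3 + b) ℓ factor) (mfrom b (0 ∷ x ∷ y ∷ L))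
    ≡⟨ coeff-band-*ₚ (+-≡⇒≤ (3 + b) e) (∏-factor-vanishes (suc b) (length L) e) L
                     (λ x' y' → coeff-∏-factor (suc b) L x' y' e) edgeTerms 0 x y ⟩
  windowCoeff x y L ∎
  where open ≡-Reasoning

twos : ℕ → List ℕ → List ℕ
twos d L = replicate d 2 ++ L

mfrom-twos : ∀ a d L → mfrom {n} a (twos d L) ≡ mfrom a (replicate d 2) ·ₘ mfrom (a + d) L
mfrom-twos a d L =
  trans (mfrom-++ a (replicate d 2) L) (cong (λ c → mfrom a (replicate d 2) ·ₘ mfrom (a + c) L) (length-replicate d))

length-twos : ∀ d L → length (twos d L) ≡ d + length L
length-twos d L = trans (length-++ (replicate d 2)) (cong (_+ length L) (length-replicate d))

m₁-window : ∀ k d → m₁ k (2 + k + d) ≡ mfrom k (1 ∷ twos d (1 ∷ 1 ∷ []))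
m₁-window k d = begin
  mvar k ·ₘ ∏ₘ (suc k) (k + d) sq ·ₘ mvar (1 + k + d) ·ₘ mvar (2 + k + d)
    ≡⟨ cong (λ S → mvar k ·ₘ S ·ₘ mvar (1 + k + d) ·ₘ mvar (2 + k + d)) (∏ₘ-sq (suc k) (k + d) d refl) ⟩
  mvar k ·ₘ S ·ₘ mvar (1 + k + d) ·ₘ mvar (2 + k + d)
    ≡⟨ regroup (mvar k) S (mvar (1 + k + d)) (mvar (2 + k + d)) ⟩
  mpow k 1 ·ₘ (S ·ₘ mfrom (1 + k + d) (1 ∷ 1 ∷ []))
    ≡⟨ cong (mpow k 1 ·ₘ_) (sym (mfrom-twos (suc k) d (1 ∷ 1 ∷ []))) ⟩
  mfrom k (1 ∷ twos d (1 ∷ 1 ∷ [])) ∎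
  where
  open ≡-Reasoning
  open MonomialSolver
  S = mfrom (suc k) (replicate d 2)
  regroup : ∀ X S A B → X ·ₘ S ·ₘ A ·ₘ B ≡ (X ·ₘ mone) ·ₘ (S ·ₘ ((A ·ₘ mone) ·ₘ ((B ·ₘ mone) ·ₘ mone)))
  regroup = solve 4 (λ X S A B → ((X ⊕ S) ⊕ A) ⊕ B ⊜ (X ⊕ id) ⊕ (S ⊕ ((A ⊕ id) ⊕ ((B ⊕ id) ⊕ id)))) refl

m₂-window : ∀ k d → m₂ k (2 + k + d) ≡ mfrom k (1 ∷ 2 ∷ twos d (0 ∷ []))
m₂-window k d = begin
  mvar k ·ₘ ∏ₘ (suc k) (1 + k + d) sq
    ≡⟨ cong (mvar k ·ₘ_) (∏ₘ-sq (suc k) (1 + k + d) (suc d) (cong suc (ℕₚ.+-suc k d))) ⟩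
  mvar k ·ₘ (mpow (suc k) 2 ·ₘ S)
    ≡⟨ regroup (mvar k) (mpow (suc k) 2) S ⟩
  mpow k 1 ·ₘ (mpow (suc k) 2 ·ₘ (S ·ₘ mfrom (2 + k + d) (0 ∷ [])))
    ≡⟨ cong (λ T → mpow k 1 ·ₘ (mpow (suc k) 2 ·ₘ T)) (sym (mfrom-twos (2 + k) d (0 ∷ []))) ⟩
  mfrom k (1 ∷ 2 ∷ twos d (0 ∷ [])) ∎
  where
  open ≡-Reasoning
  open MonomialSolver
  S = mfrom (2 + k) (replicate d 2)
  regroup : ∀ X Q S → X ·ₘ (Q ·ₘ S) ≡ (X ·ₘ mone) ·ₘ (Q ·ₘ (S ·ₘ (mone ·ₘ mone)))
  regroup = solve 3 (λ X Q S → X ⊕ (Q ⊕ S) ⊜ (X ⊕ id) ⊕ (Q ⊕ (S ⊕ (id ⊕ id)))) refl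

m₃-window : ∀ k d → m₃ k (2 + k + d) ≡ mfrom k (1 ∷ 1 ∷ twos d (1 ∷ []))
m₃-window k d = begin
  mvar k ·ₘ mvar (suc k) ·ₘ ∏ₘ (2 + k) (1 + k + d) sq ·ₘ mvar (2 + k + d)
    ≡⟨ cong (λ S → mvar k ·ₘ mvar (suc k) ·ₘ S ·ₘ mvar (2 + k + d)) (∏ₘ-sq (2 + k) (1 + k + d) d refl) ⟩
  mvar k ·ₘ mvar (suc k) ·ₘ S ·ₘ mvar (2 + k + d)
    ≡⟨ regroup (mvar k) (mvar (suc k)) S (mvar (2 + k + d)) ⟩
  mpow k 1 ·ₘ (mpow (suc k) 1 ·ₘ (S ·ₘ mfrom (2 + k + d) (1 ∷ [])))
    ≡⟨ cong (λ T → mpow k 1 ·ₘ (mpow (suc k) 1 ·ₘ T)) (sym (mfrom-twos (2 + k) d (1 ∷ []))) ⟩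
  mfrom k (1 ∷ 1 ∷ twos d (1 ∷ [])) ∎
  where
  open ≡-Reasoning
  open MonomialSolver
  S = mfrom (2 + k) (replicate d 2)
  regroup : ∀ X Y S B → X ·ₘ Y ·ₘ S ·ₘ B ≡ (X ·ₘ mone) ·ₘ ((Y ·ₘ mone) ·ₘ (S ·ₘ ((B ·ₘ mone) ·ₘ mone)))
  regroup = solve 4 (λ X Y S B → ((X ⊕ Y) ⊕ S) ⊕ B ⊜ (X ⊕ id) ⊕ ((Y ⊕ id) ⊕ (S ⊕ ((B ⊕ id) ⊕ id)))) refl

m₄-window : ∀ k d → m₄ k (2 + k + d) ≡ mfrom k (0 ∷ 2 ∷ twos d (1 ∷ []))
m₄-window k d = begin
  ∏ₘ (suc k) (1 + k + d) sq ·ₘ mvar (2 + k + d)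
    ≡⟨ cong (_·ₘ mvar (2 + k + d)) (∏ₘ-sq (suc k) (1 + k + d) (suc d) (cong suc (ℕₚ.+-suc k d))) ⟩
  mpow (suc k) 2 ·ₘ S ·ₘ mvar (2 + k + d)
    ≡⟨ regroup (mpow (suc k) 2) S (mvar (2 + k + d)) ⟩
  mone ·ₘ (mpow (suc k) 2 ·ₘ (S ·ₘ mfrom (2 + k + d) (1 ∷ [])))
    ≡⟨ cong (λ T → mone ·ₘ (mpow (suc k) 2 ·ₘ T)) (sym (mfrom-twos (2 + k) d (1 ∷ []))) ⟩
  mfrom k (0 ∷ 2 ∷ twos d (1 ∷ [])) ∎
  where
  open ≡-Reasoning
  open MonomialSolver
  S = mfrom (2 + k) (replicate d 2)
  regroup : ∀ Q S B → Q ·ₘ S ·ₘ B ≡ mone ·ₘ (Q ·ₘ (S ·ₘ ((B ·ₘ mone) ·ₘ mone)))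
  regroup = solve 3 (λ Q S B → (Q ⊕ S) ⊕ B ⊜ id ⊕ (Q ⊕ (S ⊕ ((B ⊕ id) ⊕ id)))) refl

-- Coefficients along a run of exponents 2

private
  difference : ∀ a c → 1ℤ ℤ.* a ℤ.+ (-1ℤ ℤ.* c ℤ.+ 0ℤ) ≡ a - c
  difference = solve-∀

windowCoeff-1-2 : ∀ L → windowCoeff 1 2 L ≡ tailCoeff 1 1 L - tailCoeff 0 2 L
windowCoeff-1-2 L = difference (tailCoeff 1 1 L) (tailCoeff 0 2 L)

windowCoeff-1-1 : ∀ L → windowCoeff 1 1 L ≡ tailCoeff 1 0 L - tailCoeff 0 1 L
windowCoeff-1-1 L = difference (tailCoeff 1 0 L) (tailCoeff 0 1 L)

windowCoeff-0-2 : ∀ L → windowCoeff 0 2 L ≡ tailCoeff 0 1 L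
windowCoeff-0-2 L = trans (ℤₚ.+-identityʳ _) (ℤₚ.*-identityˡ _)

tailCoeff-2 : ∀ y L → tailCoeff 2 y L ≡ 0ℤ
tailCoeff-2 y []      = refl
tailCoeff-2 y (z ∷ L) = refl

tailCoeff-0-1-2∷ : ∀ L → tailCoeff 0 1 (2 ∷ L) ≡ tailCoeff 1 0 L - tailCoeff 0 1 L
tailCoeff-0-1-2∷ L = difference (tailCoeff 1 0 L) (tailCoeff 0 1 L)

tailCoeff-1-0-2∷ : ∀ L → tailCoeff 1 0 (2 ∷ L) ≡ - tailCoeff 0 1 L
tailCoeff-1-0-2∷ L = shape (tailCoeff 0 1 L)
  where
  shape : ∀ c → 0ℤ ℤ.+ (0ℤ ℤ.+ (-1ℤ ℤ.* c ℤ.+ 0ℤ)) ≡ - c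
  shape = solve-∀

tailCoeff-1-1-2∷ : ∀ L → tailCoeff 1 1 (2 ∷ L) ≡ tailCoeff 0 2 L - tailCoeff 1 1 L
tailCoeff-1-1-2∷ L = shape (tailCoeff 1 1 L) (tailCoeff 0 2 L)
  where
  shape : ∀ a c → 0ℤ ℤ.+ (0ℤ ℤ.+ (-1ℤ ℤ.* a ℤ.+ (1ℤ ℤ.* c ℤ.+ 0ℤ))) ≡ c - a
  shape = solve-∀

tailCoeff-0-2-2∷ : ∀ L → tailCoeff 0 2 (2 ∷ L) ≡ - tailCoeff 1 1 L
tailCoeff-0-2-2∷ L =
  trans (difference (tailCoeff 2 0 L) (tailCoeff 1 1 L))
        (trans (cong (_- tailCoeff 1 1 L) (tailCoeff-2 0 L)) (ℤₚ.+-identityˡ _))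

rotate : ℤ × ℤ → ℤ × ℤ
rotate (a , c) = (c - a , - a)

rotate³ : ∀ v → rotate (rotate (rotate v)) ≡ v
rotate³ (a , c) = cong₂ _,_ (first a c) (second a c)
  where
  first : ∀ a c → - (c - a) - (- a - (c - a)) ≡ a
  first = solve-∀
  second : ∀ a c → - (- a - (c - a)) ≡ c
  second = solve-∀

pair₁ pair₂ : List ℕ → ℤ × ℤ
pair₁ L = (tailCoeff 0 1 L , tailCoeff 1 0 L)
pair₂ L = (tailCoeff 1 1 L , tailCoeff 0 2 L)

pair₁-2∷ : ∀ L → pair₁ (2 ∷ L) ≡ rotate (pair₁ L)
pair₁-2∷ L = cong₂ _,_ (tailCoeff-0-1-2∷ L) (tailCoeff-1-0-2∷ L)

pair₂-2∷ : ∀ L → pair₂ (2 ∷ L) ≡ rotate (pair₂ L)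
pair₂-2∷ L = cong₂ _,_ (tailCoeff-1-1-2∷ L) (tailCoeff-0-2-2∷ L)

rotating⇒periodic : ∀ {F : List ℕ → ℤ} (pair : List ℕ → ℤ × ℤ) (h : ℤ × ℤ → ℤ) →
                    (∀ L → pair (2 ∷ L) ≡ rotate (pair L)) → (∀ L → F L ≡ h (pair L)) →
                    ∀ L → F (2 ∷ 2 ∷ 2 ∷ L) ≡ F L
rotating⇒periodic {F} pair h pair-2∷ F≡h L = begin
  F (2 ∷ 2 ∷ 2 ∷ L)                        ≡⟨ F≡h (2 ∷ 2 ∷ 2 ∷ L) ⟩
  h (pair (2 ∷ 2 ∷ 2 ∷ L))                 ≡⟨ cong h (pair-2∷ (2 ∷ 2 ∷ L)) ⟩
  h (rotate (pair (2 ∷ 2 ∷ L)))            ≡⟨ cong (h ∘ rotate) (pair-2∷ (2 ∷ L)) ⟩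
  h (rotate (rotate (pair (2 ∷ L))))       ≡⟨ cong (h ∘ rotate ∘ rotate) (pair-2∷ L) ⟩
  h (rotate (rotate (rotate (pair L))))    ≡⟨ cong h (rotate³ (pair L)) ⟩
  h (pair L)                               ≡⟨ sym (F≡h L) ⟩
  F L                                      ∎
  where open ≡-Reasoning

periodic-≡ : ∀ {A : Set} {f g : ℕ → A} → (∀ d → f (3 + d) ≡ f d) → (∀ d → g (3 + d) ≡ g d) →
             f 0 ≡ g 0 → f 1 ≡ g 1 → f 2 ≡ g 2 → ∀ d → f d ≡ g d
periodic-≡ f-per g-per e₀ e₁ e₂ zero                = e₀
periodic-≡ f-per g-per e₀ e₁ e₂ (suc zero)          = e₁
periodic-≡ f-per g-per e₀ e₁ e₂ (suc (suc zero))    = e₂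
periodic-≡ f-per g-per e₀ e₁ e₂ (suc (suc (suc d))) =
  trans (f-per d) (trans (periodic-≡ f-per g-per e₀ e₁ e₂ d) (sym (g-per d)))

residue-periodic : ∀ d → (2 + (3 + d)) % 3 ≡ (2 + d) % 3
residue-periodic d = trans (cong (_% 3) (ℕₚ.+-comm 3 (2 + d))) ([m+n]%n≡m%n (2 + d) 3)

residueValue₁ residueValue₂ : ℕ → ℤ
residueValue₁ 0 = -1ℤ
residueValue₁ 1 = 1ℤ
residueValue₁ _ = 0ℤ
residueValue₂ 0 = 0ℤ
residueValue₂ 1 = -1ℤ
residueValue₂ _ = 1ℤ

value₁ : ∀ d → windowCoeff 1 2 (twos d (1 ∷ 1 ∷ [])) ≡ residueValue₁ ((2 + suc d) % 3)
value₁ = periodic-≡ (λ d → rotating⇒periodic pair₂ (uncurry _-_) pair₂-2∷ windowCoeff-1-2 (twos d (1 ∷ 1 ∷ [])))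
                    (λ d → cong residueValue₁ (residue-periodic (suc d))) refl refl refl

value₂ : ∀ d → windowCoeff 1 2 (twos d (0 ∷ [])) ≡ residueValue₂ ((2 + d) % 3)
value₂ = periodic-≡ (λ d → rotating⇒periodic pair₂ (uncurry _-_) pair₂-2∷ windowCoeff-1-2 (twos d (0 ∷ [])))
                    (λ d → cong residueValue₂ (residue-periodic d)) refl refl refl

value₃ : ∀ d → windowCoeff 1 1 (twos d (1 ∷ [])) ≡ - residueValue₁ ((2 + d) % 3)
value₃ = periodic-≡ (λ d → rotating⇒periodic pair₁ (uncurry (flip _-_)) pair₁-2∷ windowCoeff-1-1 (twos d (1 ∷ [])))
                    (λ d → cong (-_ ∘ residueValue₁) (residue-periodic d)) refl refl refl

value₄ : ∀ d → windowCoeff 0 2 (twos d (1 ∷ [])) ≡ - residueValue₂ ((2 + d) % 3)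
value₄ = periodic-≡ (λ d → rotating⇒periodic pair₁ proj₁ pair₁-2∷ windowCoeff-0-2 (twos d (1 ∷ [])))
                    (λ d → cong (-_ ∘ residueValue₂) (residue-periodic d)) refl refl refl

private
  fits : ∀ b {c} d → c ≡ suc d → 3 + b + c ≡ suc (3 + b + d)
  fits b d refl = ℕₚ.+-suc (3 + b) d

  length-twos-1 : ∀ d t → length (twos d (t ∷ [])) ≡ suc d
  length-twos-1 d t = trans (length-twos d (t ∷ [])) (ℕₚ.+-comm d 1)

p-m₁ : ∀ b d → p (suc b) (3 + b + d) (m₁ (suc b) (3 + b + d)) ≡ residueValue₁ ((2 + d) % 3)
p-m₁ b zero    =
  trans (cong (p (suc b) (3 + b + 0)) (m₁-window (suc b) 0)) (p-window b 1 1 (1 ∷ []) (fits b 0 refl))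
p-m₁ b (suc d) =
  trans (cong (p (suc b) (3 + b + suc d)) (m₁-window (suc b) (suc d)))
        (trans (p-window b 1 2 (twos d (1 ∷ 1 ∷ [])) (fits b (suc d) length-L)) (value₁ d))
  where
  length-L = trans (length-twos d (1 ∷ 1 ∷ [])) (ℕₚ.+-comm d 2)

p-m₂ : ∀ b d → p (suc b) (3 + b + d) (m₂ (suc b) (3 + b + d)) ≡ residueValue₂ ((2 + d) % 3)
p-m₂ b d =
  trans (cong (p (suc b) (3 + b + d)) (m₂-window (suc b) d))
        (trans (p-window b 1 2 (twos d (0 ∷ [])) (fits b d (length-twos-1 d 0))) (value₂ d))

p-m₃ : ∀ b d → p (suc b) (3 + b + d) (m₃ (suc b) (3 + b + d)) ≡ - residueValue₁ ((2 + d) % 3)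
p-m₃ b d =
  trans (cong (p (suc b) (3 + b + d)) (m₃-window (suc b) d))
        (trans (p-window b 1 1 (twos d (1 ∷ [])) (fits b d (length-twos-1 d 1))) (value₃ d))

p-m₄ : ∀ b d → p (suc b) (3 + b + d) (m₄ (suc b) (3 + b + d)) ≡ - residueValue₂ ((2 + d) % 3)
p-m₄ b d =
  trans (cong (p (suc b) (3 + b + d)) (m₄-window (suc b) d))
        (trans (p-window b 0 2 (twos d (1 ∷ [])) (fits b d (length-twos-1 d 1))) (value₄ d))

residueCases : ∀ (table : ℕ → ℤ) {a r} → a ≡ table r →
               (r ≡ 0 → a ≡ table 0) × (r ≡ 1 → a ≡ table 1) × (r ≡ 2 → a ≡ table 2)
residueCases table a≡t = at , at , at
  where
  at : ∀ {r'} → _ ≡ r' → _ ≡ table r'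
  at e = trans a≡t (cong table e)

≡-neg : ∀ {a c t : ℤ} → a ≡ t → c ≡ - t → a ≡ - c
≡-neg {t = t} a≡t c≡-t = trans a≡t (trans (sym (ℤₚ.neg-involutive t)) (cong -_ (sym c≡-t)))

[2+k+d]∸k≡2+d : ∀ k d → 2 + k + d ∸ k ≡ 2 + d
[2+k+d]∸k≡2+d k d = trans (ℕₚ.+-∸-assoc 2 (ℕₚ.m≤m+n k d)) (cong (2 +_) (ℕₚ.m+n∸m≡n k d))

proposition10 : (k ℓ : ℕ) → 1 ≤ k → k + 2 ≤ ℓ →
    ((((ℓ ∸ k) % 3 ≡ 0 → p k ℓ (m₁ k ℓ) ≡ -1ℤ)
      × ((ℓ ∸ k) % 3 ≡ 1 → p k ℓ (m₁ k ℓ) ≡ 1ℤ)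
      × ((ℓ ∸ k) % 3 ≡ 2 → p k ℓ (m₁ k ℓ) ≡ 0ℤ))
    × (((ℓ ∸ k) % 3 ≡ 0 → p k ℓ (m₂ k ℓ) ≡ 0ℤ)
      × ((ℓ ∸ k) % 3 ≡ 1 → p k ℓ (m₂ k ℓ) ≡ -1ℤ)
      × ((ℓ ∸ k) % 3 ≡ 2 → p k ℓ (m₂ k ℓ) ≡ 1ℤ))
    × (p k ℓ (m₁ k ℓ) ≡ - p k ℓ (m₃ k ℓ))
    × (p k ℓ (m₂ k ℓ) ≡ - p k ℓ (m₄ k ℓ)))
proposition10 zero    ℓ () _
proposition10 (suc b) ℓ _  k+2≤ℓ with ℕₚ.m≤n⇒∃[o]m+o≡n (subst (_≤ ℓ) (ℕₚ.+-comm (suc b) 2) k+2≤ℓ)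
... | d , refl rewrite [2+k+d]∸k≡2+d (suc b) d =
  residueCases residueValue₁ (p-m₁ b d) , residueCases residueValue₂ (p-m₂ b d) ,
  ≡-neg (p-m₁ b d) (p-m₃ b d) , ≡-neg (p-m₂ b d) (p-m₄ b d)
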